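{- Let $\Sigma$ be an action signature with enumeration $\sigma_1,\dots,\sigma_n$. For all sentences $\psi_1,\dots,\psi_n,\varphi$ of $\mathcal L(\Sigma)$, every $i$ and every agent $A$, the Action-Knowledge Axiom $$[\sigma_i\vec\psi]\Box_A\varphi\leftrightarrow\Big(\psi_i\to\bigwedge\{\Box_A[\sigma_j\vec\psi]\varphi:\sigma_i\to_A\sigma_j\text{ in }\Sigma\}\Big)$$ is valid.
   Context: Fix AtSen and Agents. A state model is $\mathbf S=(S,(\to_A)_{A\in\mathrm{Agents}},\|\cdot\|)$. An action signature $\Sigma$: finite set with relations $\to_A$ and enumeration $\sigma_1,\dots,\sigma_n$. $\mathcal L(\Sigma)$: sentences $\mathsf{true}\mid p\mid\neg\varphi\mid\varphi\wedge\psi\mid\Box_A\varphi\mid\Box^*_B\varphi\mid[\pi]\varphi$; programs $\mathsf{skip}\mid\mathsf{crash}\mid\sigma_i\psi_1\cdots\psi_n\mid\pi\cup\rho\mid\pi;\rho\mid\pi^*$. Each program gives for every $\mathbf S$ a model $\mathbf S(\pi)$ and relation $\pi_{\mathbf S}\subseteq S\times S(\pi)$; $s\in[\![[\pi]\varphi]\!]_{\mathbf S}$ iff all $\pi_{\mathbf S}$-successors of $s$ satisfy $\varphi$ in $\mathbf S(\pi)$. For $\sigma_i\vec\psi$: $\mathbf S(\sigma_i\vec\psi)$ has states $(s,\sigma_j)$ with $s\in[\![\psi_j]\!]_{\mathbf S}$, $(s,\sigma_j)\to_A(t,\sigma_k)$ iff $s\to_A t$ in $\mathbf S$ and $\sigma_j\to_A\sigma_k$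 in $\Sigma$, valuation inherited from $s$, and relation $\{(s,(s,\sigma_i)):s\in[\![\psi_i]\!]_{\mathbf S}\}$. Other programs: $\mathsf{skip}$ identity; $\mathsf{crash}$ empty; $;$ composes; $\cup$ disjoint union; $\pi^*$ union of iterates. $\Box_A$ quantifies over $\to_A$-successors, $\Box^*_B$ over the reflexive-transitive closure of $\bigcup_{A\in B}\to_A$. Valid: true at every state of every state model. Empty conjunction is $\mathsf{true}$. -}

module Defs where

open import Data.Nat using (ℕ; zero; suc)
open import Data.Fin using (Fin)
open import Data.Bool using (Bool; true)
open import Data.List using (List; []; _∷_; foldr; filter)
open import Data.Product using (Σ; _×_; _,_; proj₁; proj₂)
open import Data.Sum using (_⊎_; inj₁; inj₂)
open import Data.Empty using (⊥)
open import Data.Unit using (⊤)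
open import Data.Refinement using (Refinement; value)
open import Relation.Nullary using (¬_)
open import Relation.Binary.PropositionalEquality using (_≡_; subst)
open import Relation.Binary.Construct.Closure.ReflexiveTransitive using (Star)
open import Data.Bool using (T?)
import Data.List.Base as LB

-- Action signatures.  The carrier of an action signature with
-- enumeration σ₁,…,σₙ is represented by Fin n (σ_j is the element j);
-- the (finite, hence decidable) relations →_A are Bool-valued.

record ActionSignature (Agent : Set) : Set where
  field
    size  : ℕ
    arrow : Agent → Fin size → Fin size → Bool

record StateModel (AtSen Agent : Set) : Set₁ where
  field
    St : Set
    R  : Agent → St → St → Set
    V  : AtSen → St → Set
open StateModel public

module Logic (AtSen Agent : Set) (Sig : ActionSignature Agent) where

  open ActionSignature Sig public

  Model : Set₁
  Model = StateModel AtSen Agent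

  infixr 6 _∧_
  infixr 5 _∪_
  infixr 5 _⨟_

  mutual
    data Sentence : Set₁ where
      true   : Sentence
      atom   : AtSen → Sentence
      ¬'_    : Sentence → Sentence
      _∧_    : Sentence → Sentence → Sentence
      □      : Agent → Sentence → Sentence
      □*     : (Agent → Set) → Sentence → Sentence
      [_]_   : Program → Sentence → Sentence

    data Program : Set₁ where
      skip  : Program
      crash : Program
      act   : Fin size → (Fin size → Sentence) → Program
      _∪_   : Program → Program → Program
      _⨟_   : Program → Program → Program
      _*    : Program → Program

  _⇒_ : Sentence → Sentence → Sentence
  φ ⇒ ψ = ¬' (φ ∧ ¬' ψ)

  _⇔_ : Sentence → Sentence → Sentence
  φ ⇔ ψ = (φ ⇒ ψ) ∧ (ψ ⇒ φ)

  ⋀ : List Sentence → Sentence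
  ⋀ = foldr _∧_ true

  emptyModel : Model
  emptyModel = record { St = ⊥ ; R = λ _ _ _ → ⊥ ; V = λ _ _ → ⊥ }

  _⊎M_ : Model → Model → Model
  M ⊎M N = record
    { St = St M ⊎ St N
    ; R  = RU
    ; V  = VU
    }
    where
    RU : Agent → St M ⊎ St N → St M ⊎ St N → Set
    RU A (inj₁ x) (inj₁ y) = R M A x y
    RU A (inj₂ x) (inj₂ y) = R N A x y
    RU A _ _ = ⊥
    VU : AtSen → St M ⊎ St N → Set
    VU p (inj₁ x) = V M p x
    VU p (inj₂ x) = V N p x

  mutual
    Sat : Sentence → (M : Model) → St M → Set
    Sat true      M s = ⊤
    Sat (atom p)  M s = V M p s
    Sat (¬' φ)    M s = ¬ Sat φ M s
    Sat (φ ∧ ψ)   M s = Sat φ M s × Sat ψ M s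
    Sat (□ A φ)   M s = ∀ t → R M A s t → Sat φ M t
    Sat (□* B φ)  M s = ∀ t → Star (λ x y → Σ Agent λ A → B A × R M A x y) s t → Sat φ M t
    Sat ([ π ] φ) M s = ∀ t → Rel π M s t → Sat φ (Mod π M) t

    Mod : Program → Model → Model
    Mod skip      M = M
    Mod crash     M = emptyModel
    Mod (act i ψ) M = record
      { St = Refinement (St M × Fin size) (λ sj → Sat (ψ (proj₂ sj)) M (proj₁ sj))
      ; R  = λ A x y → R M A (proj₁ (value x)) (proj₁ (value y))
                       × arrow A (proj₂ (value x)) (proj₂ (value y)) ≡ true
      ; V  = λ p x → V M p (proj₁ (value x))
      }
    Mod (π ∪ ρ)   M = Mod π M ⊎M Mod ρ M
    Mod (π ⨟ ρ)   M = Mod ρ (Mod π M)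
    Mod (π *)     M = record
      { St = Σ ℕ (λ k → St (iterM π k M))
      ; R  = λ A x y → Σ (proj₁ x ≡ proj₁ y) λ e →
                 R (iterM π (proj₁ y) M) A (subst (λ k → St (iterM π k M)) e (proj₂ x)) (proj₂ y)
      ; V  = λ p x → V (iterM π (proj₁ x) M) p (proj₂ x)
      }

    Rel : (π : Program) (M : Model) → St M → St (Mod π M) → Set
    Rel skip      M s t = s ≡ t
    Rel crash     M s t = ⊥
    Rel (act i ψ) M s x = value x ≡ (s , i)
    Rel (π ∪ ρ)   M s (inj₁ t) = Rel π M s t
    Rel (π ∪ ρ)   M s (inj₂ t) = Rel ρ M s t
    Rel (π ⨟ ρ)   M s t = Σ (St (Mod π M)) λ u → Rel π M s u × Rel ρ (Mod π M) u t
    Rel (π *)     M s (k , t) = iterR π k M s t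

    -- S(π^k) with π^0 = skip, π^(k+1) = π^k ; π
    iterM : Program → ℕ → Model → Model
    iterM π zero    M = M
    iterM π (suc k) M = Mod π (iterM π k M)

    iterR : (π : Program) (k : ℕ) (M : Model) → St M → St (iterM π k M) → Set
    iterR π zero    M s t = s ≡ t
    iterR π (suc k) M s t = Σ (St (iterM π k M)) λ u → iterR π k M s u × Rel π (iterM π k M) u t

  Valid : Sentence → Set₁
  Valid φ = (M : Model) (s : St M) → Sat φ M s

  successors : Agent → Fin size → List (Fin size)
  successors A i = filter (λ j → T? (arrow A i j)) (LB.allFin size)

-- The model S(σᵢψ⃗) does not depend on i: it is the product update of S by the action
-- signature with preconditions ψ⃗, and σᵢψ⃗ merely picks the copy (s, σᵢ) of s, which exists
-- iff ψᵢ holds at s.  The A-successors of (s, σᵢ) are the (t, σⱼ) with s →_A t and σᵢ →_A σⱼ,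
-- that is, the σⱼψ⃗-successors of the A-successors of s.  This proves the axiom with the
-- connectives read in the metalanguage, which suffices constructively because the object-level
-- ⇒ and ⇔ are negated conjunctions.
module Submission where

open import Defs
open import Data.Fin using (Fin)
open import Data.List using ([]; _∷_; map; allFin)
open import Data.List.Membership.Propositional using (_∈_)
open import Data.List.Membership.Propositional.Properties using (∈-filter⁺; ∈-filter⁻; ∈-allFin)
open import Data.List.Relation.Unary.All as All using (All; []; _∷_)
open import Data.List.Relation.Unary.All.Properties using (map⁺; map⁻)
open import Data.Product using (_×_; _,_; proj₂)
open import Data.Unit using (tt)
open import Data.Bool using (true; T; T?)
open import Data.Bool.Properties using (T-≡)
open import Data.Irrelevant using () renaming ([_] to irr)
open import Data.Refinement using (value; _,_)
open import Function using (_∘_; Equivalence; mk⇔) renaming (_⇔_ to _⟺_)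
open import Function.Properties.Equivalence using () renaming (trans to ⟺-trans)
open import Relation.Binary.PropositionalEquality using (_≡_; refl)
open import Relation.Nullary using (¬_; Dec)
open import Relation.Nullary.Negation using (contradiction-irr)

open Equivalence

-- The right-hand side is Sat (φ ⇔ (χ ⇒ θ)) M s unfolded, for L, P, Q the satisfaction of φ, χ, θ.
⟺⇒negative-⇔-⇒ : {L P Q : Set} → (L ⟺ (.P → Q)) →
                  ¬ (L × ¬ ¬ (P × ¬ Q)) × ¬ (¬ (P × ¬ Q) × ¬ L)
⟺⇒negative-⇔-⇒ {L} {P} {Q} e = forward , backward
  where
  forward : ¬ (L × ¬ ¬ (P × ¬ Q))
  forward (l , ¬¬[p×¬q]) = ¬¬[p×¬q] (λ (p , ¬q) → ¬q (to e l p))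

  backward : ¬ (¬ (P × ¬ Q) × ¬ L)
  backward (¬[p×¬q] , ¬l) = ¬¬p (λ p → ¬[p×¬q] (p , ¬q))
    where
    ¬[p⇒q] : ¬ (.P → Q)
    ¬[p⇒q] = ¬l ∘ from e
    ¬q : ¬ Q
    ¬q q = ¬[p⇒q] (λ _ → q)
    ¬¬p : ¬ ¬ P
    ¬¬p ¬p = ¬[p⇒q] (λ .p → contradiction-irr p ¬p)

module _ {AtSen Agent : Set} (Sig : ActionSignature Agent) where
  open Logic AtSen Agent Sig

  Sat-⋀ : ∀ {M s φs} → Sat (⋀ φs) M s ⟺ All (λ φ → Sat φ M s) φs
  Sat-⋀ {M} {s} = mk⇔ to′ from′
    where
    to′ : ∀ {φs} → Sat (⋀ φs) M s → All (λ φ → Sat φ M s) φs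
    to′ {[]}    tt       = []
    to′ {_ ∷ _} (a , as) = a ∷ to′ as
    from′ : ∀ {φs} → All (λ φ → Sat φ M s) φs → Sat (⋀ φs) M s
    from′ []       = tt
    from′ (a ∷ as) = a , from′ as

  ∈-successors : ∀ {A i j} → j ∈ successors A i ⟺ arrow A i j ≡ true
  ∈-successors {A} {i} {j} = mk⇔
    (to T-≡ ∘ proj₂ ∘ ∈-filter⁻ P? {xs = allFin size})
    (λ e → ∈-filter⁺ P? (∈-allFin j) (from T-≡ e))
    where
    P? : ∀ k → Dec (T (arrow A i k))
    P? k = T? (arrow A i k)

  All-successors : ∀ {A i} {P : Fin size → Set} →
                   All P (successors A i) ⟺ (∀ {j} → arrow A i j ≡ true → P j)
  All-successors {A} {i} = mk⇔
    (λ ps {j} e → All.lookup ps (from (∈-successors {A} {i} {j}) e))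
    (λ f → All.tabulate (λ {j} m → f (to (∈-successors {A} {i} {j}) m)))

  Sat-⋀-successors : ∀ M s (f : Fin size → Sentence) A i →
    Sat (⋀ (map f (successors A i))) M s ⟺ (∀ {j} → arrow A i j ≡ true → Sat (f j) M s)
  Sat-⋀-successors M s f A i = ⟺-trans Sat-⋀ (⟺-trans (mk⇔ map⁻ map⁺) All-successors)

  -- A state of S(σᵢψ⃗) carries its proof of ψᵢ only irrelevantly, so the precondition enters
  -- as an irrelevant hypothesis.
  Sat-[act] : ∀ M s i ψ φ →
    Sat ([ act i ψ ] φ) M s ⟺ (.(p : Sat (ψ i) M s) → Sat φ (Mod (act i ψ) M) ((s , i) , irr p))
  Sat-[act] M s i ψ φ = mk⇔ (λ h .p → h _ refl) (λ { h ((_ , _) , irr p) refl → h p })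

  Sat-□-act : ∀ M k ψ φ A (x : St (Mod (act k ψ) M)) →
    let (s , i) = value x in
    Sat (□ A φ) (Mod (act k ψ) M) x ⟺ (∀ {j} → arrow A i j ≡ true → Sat (□ A ([ act j ψ ] φ)) M s)
  Sat-□-act M k ψ φ A x = mk⇔
    (λ h {j} i→j t s→t → λ { ((_ , _) , _) refl → h _ (s→t , i→j) })
    (λ { h ((t , _) , _) (s→t , i→j) → h i→j t s→t _ refl })

  actionKnowledge : ∀ ψ φ i A M s →
    Sat ([ act i ψ ] □ A φ) M s ⟺
    (.(Sat (ψ i) M s) → Sat (⋀ (map (λ j → □ A ([ act j ψ ] φ)) (successors A i))) M s)
  actionKnowledge ψ φ i A M s = mk⇔
    (λ h .p → from (Sat-⋀-successors M s f A i)
                (to (Sat-□-act M i ψ φ A (state p)) (to (Sat-[act] M s i ψ (□ A φ)) h p)))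
    (λ h → from (Sat-[act] M s i ψ (□ A φ))
             (λ .p → from (Sat-□-act M i ψ φ A (state p)) (to (Sat-⋀-successors M s f A i) (h p))))
    where
    f : Fin size → Sentence
    f j = □ A ([ act j ψ ] φ)
    state : .(Sat (ψ i) M s) → St (Mod (act i ψ) M)
    state p = (s , i) , irr p

mainTheorem17 : {AtSen Agent : Set} (Sig : ActionSignature Agent) →
    let open Logic AtSen Agent Sig in
    (ψ : Fin size → Sentence) (φ : Sentence) (i : Fin size) (A : Agent) →
    Valid (([ act i ψ ] □ A φ) ⇔ (ψ i ⇒ ⋀ (map (λ j → □ A ([ act j ψ ] φ)) (successors A i))))
mainTheorem17 Sig ψ φ i A M s = ⟺⇒negative-⇔-⇒ (actionKnowledge Sig ψ φ i A M s)
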